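{- Let $\Gamma$ be an infinite abelian group and $F\colon\Gamma\to\Gamma$ an injective endomorphism, and suppose $\Gamma$ admits an $F^r$-spanning set for some $r>0$. If $m\ge1$ and $X\subseteq\Gamma^m$ is definable in $(\Gamma,+)$ with parameters from $\Gamma$, then $X$ is $F$-automatic (as a subset of the group $\Gamma^m$ equipped with the coordinatewise endomorphism $F\times\cdots\times F$).
   Context: For an abelian group $\Delta$, an endomorphism $G$ and a string $\sigma=s_0\cdots s_n$ of elements of $\Delta$, $[\sigma]_G=s_0+Gs_1+\cdots+G^ns_n$. $\Lambda^*$ denotes finite strings over $\Lambda$. A finite $\Sigma\subseteq\Delta$ is a $G$-spanning set for $\Delta$ if: (i) every $a\in\Delta$ equals $[\sigma]_G$ for some $\sigma\in\Sigma^*$; (ii) $0\in\Sigma$ and $\Sigma=-\Sigma$; (iii) for $a_1,\dots,a_5\in\Sigma$, $a_1+\cdots+a_5\in\Sigma+G\Sigma$; (iv) if $a_1,a_2,a_3\in\Sigma$ and $a_1+a_2+a_3\in G\Delta$ then $a_1+a_2+a_3\in G\Sigma$. For injective $G$, $X\subseteq\Delta$ is $G$-automatic if there are $r>0$ and a $G^r$-spanning set $\Sigma$ for $\Delta$ with $\{\sigma\in\Sigma^*:[\sigma]_{G^r}\in X\}$ a regular language over the alphabet $\Sigma$. -}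

module Defs where

open import Level using (Level; _⊔_; Lift)
open import Data.Nat using (ℕ; zero; suc; _>_; _≥_)
open import Data.Fin using (Fin)
open import Data.Bool using (Bool; true)
open import Data.List using (List; []; _∷_; map; foldl)
open import Data.Product using (Σ; ∃; _×_; _,_)
open import Data.Vec.Functional as VF using ()
open import Relation.Binary.PropositionalEquality using (_≡_)
open import Relation.Nullary using (¬_)
open import Function.Bundles using (_⇔_)
open import Algebra.Bundles using (AbelianGroup)
open import Algebra.Bundles.Raw using (RawGroup)

private variable c ℓ p : Level

iter : {A : Set c} → (A → A) → ℕ → A → A
iter G zero    x = x
iter G (suc n) x = G (iter G n x)

record DFA (k : ℕ) : Set where
  field
    nStates : ℕ
    start   : Fin nStates
    δ       : Fin nStates → Fin k → Fin nStates
    final   : Fin nStates → Bool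

  run : Fin nStates → List (Fin k) → Fin nStates
  run q w = foldl δ q w

  accepts : List (Fin k) → Bool
  accepts w = final (run start w)

Regular : (k : ℕ) → (List (Fin k) → Set p) → Set p
Regular k L = Σ (DFA k) λ A → ∀ w → (DFA.accepts A w ≡ true) ⇔ L w

-- Spanning sets and automaticity, for an abelian group Δ written
-- additively via its raw group structure (_∙_ = +, ε = 0, _⁻¹ = negation).

module _ (Δ : RawGroup c ℓ) where
  open RawGroup Δ

  ⟦_⟧[_] : List Carrier → (Carrier → Carrier) → Carrier
  ⟦ []    ⟧[ G ] = ε
  ⟦ s ∷ σ ⟧[ G ] = s ∙ G ⟦ σ ⟧[ G ]

  -- A finite subset Σ of Δ is given by an injective (w.r.t. ≈)
  -- enumeration Σ : Fin k → Carrier; strings over Σ are lists of indices.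
  record IsSpanningSet (G : Carrier → Carrier) (k : ℕ) (S : Fin k → Carrier)
         : Set (c ⊔ ℓ) where
    field
      distinct : ∀ i j → S i ≈ S j → i ≡ j
      spans    : ∀ a → Σ (List (Fin k)) λ σ → ⟦ map S σ ⟧[ G ] ≈ a
      has-zero : Σ (Fin k) λ i → S i ≈ ε
      neg-⊆    : ∀ i → Σ (Fin k) λ j → S j ≈ (S i) ⁻¹
      neg-⊇    : ∀ i → Σ (Fin k) λ j → S i ≈ (S j) ⁻¹
      -- (iii)
      five-sum : ∀ i₁ i₂ i₃ i₄ i₅ → Σ (Fin k) λ j → Σ (Fin k) λ j' →
                 S i₁ ∙ S i₂ ∙ S i₃ ∙ S i₄ ∙ S i₅ ≈ S j ∙ G (S j')
      -- (iv)
      three-sum : ∀ i₁ i₂ i₃ → (Σ Carrier λ d → S i₁ ∙ S i₂ ∙ S i₃ ≈ G d) →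
                  Σ (Fin k) λ j → S i₁ ∙ S i₂ ∙ S i₃ ≈ G (S j)

  HasSpanningSet : (Carrier → Carrier) → Set (c ⊔ ℓ)
  HasSpanningSet G = Σ ℕ λ k → Σ (Fin k → Carrier) λ S → IsSpanningSet G k S

  Automatic : (Carrier → Carrier) → (Carrier → Set p) → Set (c ⊔ ℓ ⊔ p)
  Automatic G X =
    Σ ℕ λ r → r > 0 × (Σ ℕ λ k → Σ (Fin k → Carrier) λ S →
      IsSpanningSet (iter G r) k S ×
      Regular k (λ σ → X ⟦ map S σ ⟧[ iter G r ]))

module _ (Γ : AbelianGroup c ℓ) where
  open AbelianGroup Γ

  record IsInjectiveEndo (F : Carrier → Carrier) : Set (c ⊔ ℓ) where
    field
      cong      : ∀ {x y} → x ≈ y → F x ≈ F y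
      homo      : ∀ x y → F (x ∙ y) ≈ F x ∙ F y
      injective : ∀ {x y} → F x ≈ F y → x ≈ y

  Infinite : Set (c ⊔ ℓ)
  Infinite = ∀ n (f : Fin n → Carrier) → ¬ (∀ x → Σ (Fin n) λ i → f i ≈ x)

  power : ℕ → RawGroup c ℓ
  power m = record
    { Carrier = Fin m → Carrier
    ; _≈_     = λ u v → ∀ i → u i ≈ v i
    ; _∙_     = λ u v i → u i ∙ v i
    ; ε       = λ _ → ε
    ; _⁻¹     = λ u i → (u i) ⁻¹
    }

  powerMap : (m : ℕ) → (Carrier → Carrier) → (Fin m → Carrier) → (Fin m → Carrier)
  powerMap m F u i = F (u i)

  data Term (n : ℕ) : Set c where
    var   : Fin n → Term n
    param : Carrier → Term n
    _⊕_   : Term n → Term n → Term n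

  data Formula (n : ℕ) : Set c where
    _≐_  : Term n → Term n → Formula n
    ¬'_  : Formula n → Formula n
    _∧'_ : Formula n → Formula n → Formula n
    ∃'_  : Formula (suc n) → Formula n

  evalT : ∀ {n} → (Fin n → Carrier) → Term n → Carrier
  evalT ρ (var i)   = ρ i
  evalT ρ (param a) = a
  evalT ρ (s ⊕ t)   = evalT ρ s ∙ evalT ρ t

  -- Tarski semantics (classical once excluded middle is assumed).
  Sat : ∀ {n} → (Fin n → Carrier) → Formula n → Set (c ⊔ ℓ)
  Sat ρ (s ≐ t)  = Lift c (evalT ρ s ≈ evalT ρ t)
  Sat ρ (¬' φ)   = ¬ Sat ρ φ
  Sat ρ (φ ∧' ψ) = Sat ρ φ × Sat ρ ψ
  Sat ρ (∃' φ)   = Σ Carrier λ a → Sat (a VF.∷ ρ) φ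

  Definable : (m : ℕ) → ((Fin m → Carrier) → Set p) → Set (c ⊔ ℓ ⊔ p)
  Definable m X = Σ (Formula m) λ φ → ∀ u → X u ⇔ Sat u φ

module Submission where

-- Points of Γᵐ are written as words of columns of digits from the spanning set S, and the set of
-- words whose value satisfies a formula φ is shown to be recognizable by induction on φ. Negation
-- and conjunction are closure properties of recognizable languages; an existential quantifier is
-- the image under deleting a row, followed by padding with zero columns, since a witness may need
-- more digits than the other coordinates. For an atom s ≐ t, the value of s - t is a fixed
-- expansion plus the columnwise digits, and the automaton checks that this sum vanishes by
-- remembering the carry. Properties (iii) and (iv) of spanning sets keep every carry a sum of
-- boundedly many generators (plus a suffix of the fixed expansion), so only finitely many carries
-- occur. Finally, the columns themselves form a spanning set of Γᵐ for the coordinatewise Fʳ.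

open import Defs
open import Level using (Level; 0ℓ; _⊔_; Lift; lift; lower)
open import Axiom.ExcludedMiddle using (ExcludedMiddle)
open import Function using (_∘_; _⇔_; mk⇔; Equivalence)
open import Data.Empty using (⊥-elim)
open import Data.Product using (Σ; ∃; ∃₂; _×_; _,_; proj₁; proj₂)
open import Data.Bool using (Bool; true; false)
open import Data.Bool.Properties using (T-≡)
open import Data.Maybe using (Maybe; just; nothing)
import Data.Maybe.Relation.Binary.Pointwise as Maybeₚ
open import Data.Nat using (ℕ; zero; suc; _+_; _*_; _^_; _>_; _≥_; _≤_; z≤n; s≤s)
open import Data.Nat.Properties using (≤-trans; ≤-reflexive; m≤m+n; n≤1+n)
open import Data.Nat.Tactic.RingSolver using (solve-∀)
open import Data.Fin using (Fin; finToFun; funToFin; combine)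
open import Data.Fin.Properties using (funToFin-finToFin; finToFun-funToFin)
open import Data.List
  using (List; []; _∷_; [_]; _++_; _∷ʳ_; lookup; map; foldl; length; replicate; tails;
         allFin; cartesianProduct; cartesianProductWith)
open import Data.List.Properties
  using (foldl-++; foldl-∷ʳ; ∷ʳ-++; ++-identityʳ; ∷-injective; map-++; map-∘; map-replicate)
open import Data.List.Membership.Propositional using (_∈_)
open import Data.List.Membership.Propositional.Properties
  using (∈-cartesianProduct⁺; ∈-cartesianProductWith⁺; ∈-allFin; ∈-map⁺)
import Data.List.Membership.Setoid as SetoidMembership
import Data.List.Relation.Unary.Any as Any
open import Data.List.Relation.Unary.Any using (here; there)
open import Data.List.Relation.Unary.Any.Properties using (lookup-index)
open import Data.List.Relation.Unary.All using (All; []; _∷_; universal)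
open import Data.List.Relation.Unary.All.Properties using (map⁺)
open import Data.Vec as Vec using (Vec; []; _∷_; tabulate)
open import Data.Vec.Properties using (lookup∘tabulate; tabulate-cong)
import Data.Vec.Functional as VF
open import Relation.Binary.Bundles using (Setoid)
open import Relation.Binary.PropositionalEquality as ≡ using (_≡_)
open import Relation.Nullary using (¬_; Dec; yes; no)
open import Relation.Nullary.Decidable using (isYes; map′; toWitness; fromWitness)
open import Algebra.Bundles using (AbelianGroup)

private variable
  a e l l' : Level
  A B : Set

lowerExcludedMiddle : ExcludedMiddle (a ⊔ l) → ExcludedMiddle a
lowerExcludedMiddle {l = l} em {P} = map′ lower lift (em {Lift l P})

isYes≡true⇔ : {P : Set l} (d : Dec P) → isYes d ≡ true ⇔ P
isYes≡true⇔ d = mk⇔ (λ eq → toWitness (Equivalence.from T-≡ eq)) (λ x → Equivalence.to T-≡ (fromWitness x))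

isYes-cong : {P : Set a} {Q : Set l} → (P → Q) → (Q → P) → (p? : Dec P) (q? : Dec Q) → isYes p? ≡ isYes q?
isYes-cong f g (yes p) (yes q) = ≡.refl
isYes-cong f g (yes p) (no ¬q) = ⊥-elim (¬q (f p))
isYes-cong f g (no ¬p) (yes q) = ⊥-elim (¬p (g q))
isYes-cong f g (no ¬p) (no ¬q) = ≡.refl

length-∷ʳ : {X : Set a} (xs : List X) (x : X) → length (xs ∷ʳ x) ≡ suc (length xs)
length-∷ʳ []       x = ≡.refl
length-∷ʳ (_ ∷ xs) x = ≡.cong suc (length-∷ʳ xs x)

map-∷ʳ⁻ : (π : B → A) (u : List B) {w : List A} {x : A} → map π u ≡ w ∷ʳ x →
  ∃₂ λ u₀ y → u ≡ u₀ ∷ʳ y × map π u₀ ≡ w × π y ≡ x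
map-∷ʳ⁻ π []          {[]}    ()
map-∷ʳ⁻ π []          {_ ∷ _} ()
map-∷ʳ⁻ π (y ∷ [])    {[]}    ≡.refl = [] , y , ≡.refl , ≡.refl , ≡.refl
map-∷ʳ⁻ π (y ∷ _ ∷ _) {[]}    ()
map-∷ʳ⁻ π (y ∷ u)     {_ ∷ w} eq with ≡.refl , eq' ← ∷-injective eq
  with u₀ , y' , ≡.refl , ≡.refl , ≡.refl ← map-∷ʳ⁻ π u eq' = y ∷ u₀ , y' , ≡.refl , ≡.refl , ≡.refl

allVecs : List A → (n : ℕ) → List (Vec A n)
allVecs xs zero    = [ [] ]
allVecs xs (suc n) = cartesianProductWith _∷_ xs (allVecs xs n)

∈-allVecs : {xs : List A} → (∀ x → x ∈ xs) → ∀ {n} (v : Vec A n) → v ∈ allVecs xs n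
∈-allVecs all∈ []      = here ≡.refl
∈-allVecs all∈ (x ∷ v) = ∈-cartesianProductWith⁺ _∷_ (all∈ x) (∈-allVecs all∈ v)

funToFin-cong : ∀ {m n} {f g : Fin m → Fin n} → (∀ i → f i ≡ g i) → funToFin f ≡ funToFin g
funToFin-cong {zero}  f≗g = ≡.refl
funToFin-cong {suc m} f≗g = ≡.cong₂ combine (f≗g Fin.zero) (funToFin-cong (f≗g ∘ Fin.suc))

iter-suc : {X : Set a} (G : X → X) (n : ℕ) (x : X) → iter G (suc n) x ≡ iter G n (G x)
iter-suc G zero    x = ≡.refl
iter-suc G (suc n) x = ≡.cong G (iter-suc G n x)

-- Recognizable languages

record Automaton (A : Set) : Set where
  field
    nStates : ℕ
    start   : Fin nStates
    step    : Fin nStates → A → Fin nStates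

  reach : List A → Fin nStates
  reach = foldl step start

-- Accepting states are left implicit: with excluded middle they are the states reached by words of L.
Recognizable : (A : Set) → (List A → Set l) → Set l
Recognizable A L = Σ (Automaton A) λ M →
  ∀ {w w'} → Automaton.reach M w ≡ Automaton.reach M w' → L w → L w'

Recognizable⇒Regular : ∀ {k} {L : List (Fin k) → Set l} →
  ExcludedMiddle l → Recognizable (Fin k) L → Regular k L
Recognizable⇒Regular {l = l} {k = k} {L} em (M , saturated) = dfa , λ w → mk⇔ (accepted⇒L w) (L⇒accepted w)
  where
  open Automaton M
  ReachedFromL : Fin nStates → Set l
  ReachedFromL i = Σ (List (Fin k)) λ w → reach w ≡ i × L w
  dfa : DFA k
  dfa = record { nStates = nStates ; start = start ; δ = step ; final = λ i → isYes (em {ReachedFromL i}) }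
  accepted⇒L : ∀ w → DFA.accepts dfa w ≡ true → L w
  accepted⇒L w acc with (w' , eq , l) ← Equivalence.to (isYes≡true⇔ em) acc = saturated eq l
  L⇒accepted : ∀ w → L w → DFA.accepts dfa w ≡ true
  L⇒accepted w l = Equivalence.from (isYes≡true⇔ em) (w , ≡.refl , l)

Recognizable-resp : {L : List A → Set l} {L' : List A → Set l'} →
  (∀ w → L w ⇔ L' w) → Recognizable A L → Recognizable A L'
Recognizable-resp L⇔L' (M , saturated) =
  M , λ {w} {w'} eq l → Equivalence.to (L⇔L' w') (saturated eq (Equivalence.from (L⇔L' w) l))

Recognizable-¬ : {L : List A → Set l} → Recognizable A L → Recognizable A (¬_ ∘ L)
Recognizable-¬ (M , saturated) = M , λ eq ¬l l' → ¬l (saturated (≡.sym eq) l')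

Recognizable-map : {L : List A → Set l} (h : B → A) → Recognizable A L → Recognizable B (L ∘ map h)
Recognizable-map {B = B} h (M , saturated) = M' , λ {w} {w'} eq → saturated (reach-map {w} {w'} eq)
  where
  open Automaton M
  M' : Automaton B
  M' = record { nStates = nStates ; start = start ; step = λ i b → step i (h b) }
  run-map : ∀ i w → foldl (Automaton.step M') i w ≡ foldl step i (map h w)
  run-map i []      = ≡.refl
  run-map i (b ∷ w) = run-map (step i (h b)) w
  reach-map : ∀ {w w'} → Automaton.reach M' w ≡ Automaton.reach M' w' → reach (map h w) ≡ reach (map h w')
  reach-map {w} {w'} eq = ≡.trans (≡.sym (run-map start w)) (≡.trans eq (run-map start w'))

Recognizable-padded : {L : List A → Set l} (z : A) →
  Recognizable A L → Recognizable A (λ w → ∃ λ p → L (w ++ replicate p z))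
Recognizable-padded z (M , saturated) = M , λ {w} {w'} eq (p , l) → p , saturated (reach-++ w w' eq) l
  where
  open Automaton M
  reach-++ : ∀ w w' {v} → reach w ≡ reach w' → reach (w ++ v) ≡ reach (w' ++ v)
  reach-++ w w' {v} eq =
    ≡.trans (foldl-++ step start w v) (≡.trans (≡.cong (λ i → foldl step i v) eq) (≡.sym (foldl-++ step start w' v)))

record FiniteRightCongruence (K : Setoid a e) (A : Set) (L : List A → Set l) : Set (a ⊔ e ⊔ l) where
  open Setoid K
  open SetoidMembership K using () renaming (_∈_ to _∈ₖ_)
  field
    class           : List A → Carrier
    classes         : List Carrier
    class∈classes   : ∀ w → class w ∈ₖ classes
    class-∷ʳ        : ∀ {w w'} x → class w ≈ class w' → class (w ∷ʳ x) ≈ class (w' ∷ʳ x)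
    class-saturates : ∀ {w w'} → class w ≈ class w' → L w → L w'

FiniteRightCongruence⇒Recognizable : {K : Setoid a e} {L : List A → Set l} →
  ExcludedMiddle e → FiniteRightCongruence K A L → Recognizable A L
FiniteRightCongruence⇒Recognizable {A = A} {K = K} em C = M , λ {w} {w'} eq → class-saturates (reach-class w w' eq)
  where
  open Setoid K
  open FiniteRightCongruence C
  State : Set
  State = Fin (length classes)

  index : List A → State
  index w = Any.index (class∈classes w)

  step : State → A → State
  step i x with em {Σ (List A) λ w → class w ≈ lookup classes i}
  ... | yes (w , _) = index (w ∷ʳ x)
  ... | no _        = i

  M : Automaton A
  M = record { nStates = length classes ; start = index [] ; step = step }

  step-class : ∀ {u} i x → class u ≈ lookup classes i → class (u ∷ʳ x) ≈ lookup classes (step i x)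
  step-class {u} i x u∈i with em {Σ (List A) λ w → class w ≈ lookup classes i}
  ... | yes (w , w∈i) = trans (class-∷ʳ x (trans u∈i (sym w∈i))) (lookup-index (class∈classes (w ∷ʳ x)))
  ... | no ∄w         = ⊥-elim (∄w (u , u∈i))

  run-class : ∀ u v i → class u ≈ lookup classes i → class (u ++ v) ≈ lookup classes (foldl step i v)
  run-class u []      i u∈i = ≡.subst (λ z → class z ≈ _) (≡.sym (++-identityʳ u)) u∈i
  run-class u (x ∷ v) i u∈i =
    ≡.subst (λ z → class z ≈ _) (∷ʳ-++ u x v) (run-class (u ∷ʳ x) v (step i x) (step-class i x u∈i))

  reach-class : ∀ w w' → Automaton.reach M w ≡ Automaton.reach M w' → class w ≈ class w'
  reach-class w w' eq = trans (run-class [] w _ start-class)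
    (sym (≡.subst (λ i → class w' ≈ lookup classes i) (≡.sym eq) (run-class [] w' _ start-class)))
    where
    start-class : class [] ≈ lookup classes (index [])
    start-class = lookup-index (class∈classes [])

Recognizable-× : {L : List A → Set l} {L' : List A → Set l'} → ExcludedMiddle 0ℓ →
  Recognizable A L → Recognizable A L' → Recognizable A (λ w → L w × L' w)
Recognizable-× em (M , saturated) (M' , saturated') =
  FiniteRightCongruence⇒Recognizable {K = ≡.setoid _} em record
    { class           = λ w → reach M w , reach M' w
    ; classes         = cartesianProduct (allFin _) (allFin _)
    ; class∈classes   = λ w → ∈-cartesianProduct⁺ (∈-allFin _) (∈-allFin _)
    ; class-∷ʳ        = λ {w} {w'} x eq →
        ≡.cong₂ _,_ (reach-∷ʳ M w w' x (≡.cong proj₁ eq)) (reach-∷ʳ M' w w' x (≡.cong proj₂ eq))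
    ; class-saturates = λ eq (l , l') → saturated (≡.cong proj₁ eq) l , saturated' (≡.cong proj₂ eq) l'
    }
  where
  open Automaton using (reach)
  reach-∷ʳ : ∀ N w w' x → reach N w ≡ reach N w' → reach N (w ∷ʳ x) ≡ reach N (w' ∷ʳ x)
  reach-∷ʳ N w w' x eq = let open Automaton N in
    ≡.trans (foldl-∷ʳ step start x w) (≡.trans (≡.cong (λ i → step i x) eq) (≡.sym (foldl-∷ʳ step start x w')))

Recognizable-image : {L : List B → Set l} (π : B → A) → ExcludedMiddle 0ℓ →
  Recognizable B L → Recognizable A (λ w → ∃ λ u → map π u ≡ w × L u)
Recognizable-image {A = A} π em (M , saturated) =
  FiniteRightCongruence⇒Recognizable {K = ≡.setoid _} em record
    { class           = class
    ; classes         = allVecs (true ∷ false ∷ []) nStates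
    ; class∈classes   = λ w → ∈-allVecs (λ { true → here ≡.refl ; false → there (here ≡.refl) }) (class w)
    ; class-∷ʳ        = λ x eq → tabulate-cong λ i →
        isYes-cong (above-∷ʳ x i eq) (above-∷ʳ x i (≡.sym eq)) em em
    ; class-saturates = λ eq (u , πu≡w , l) →
        let u' , πu'≡w' , eq' = transfer eq (u , πu≡w , ≡.refl) in u' , πu'≡w' , saturated (≡.sym eq') l
    }
  where
  open Automaton M
  Above : List A → Fin nStates → Set
  Above w i = ∃ λ u → map π u ≡ w × reach u ≡ i
  class : List A → Vec Bool nStates
  class w = tabulate λ i → isYes (em {Above w i})

  transfer : ∀ {w w' i} → class w ≡ class w' → Above w i → Above w' i
  transfer {w} {w'} {i} eq above = Equivalence.to (isYes≡true⇔ em) (begin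
    isYes (em {Above w' i}) ≡⟨ lookup∘tabulate _ i ⟨
    Vec.lookup (class w') i ≡⟨ ≡.cong (λ v → Vec.lookup v i) eq ⟨
    Vec.lookup (class w) i  ≡⟨ lookup∘tabulate _ i ⟩
    isYes (em {Above w i})  ≡⟨ Equivalence.from (isYes≡true⇔ em) above ⟩
    true                    ∎)
    where open ≡.≡-Reasoning

  above-∷ʳ : ∀ {w w'} x i → class w ≡ class w' → Above (w ∷ʳ x) i → Above (w' ∷ʳ x) i
  above-∷ʳ {w' = w'} x i eq (u , πu≡wx , reach-u) with u₀ , y , ≡.refl , ≡.refl , ≡.refl ← map-∷ʳ⁻ π u πu≡wx
    with u₀' , ≡.refl , reach-u₀' ← transfer eq (u₀ , ≡.refl , ≡.refl) =
    u₀' ∷ʳ y , map-++ π u₀' [ y ] , (begin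
      reach (u₀' ∷ʳ y)     ≡⟨ foldl-∷ʳ step start y u₀' ⟩
      step (reach u₀') y   ≡⟨ ≡.cong (λ j → step j y) reach-u₀' ⟩
      step (reach u₀) y    ≡⟨ foldl-∷ʳ step start y u₀ ⟨
      reach (u₀ ∷ʳ y)      ≡⟨ reach-u ⟩
      i                    ∎)
    where open ≡.≡-Reasoning

module _ {c ℓ} (Γ : AbelianGroup c ℓ) where
  open AbelianGroup Γ
  open import Algebra.Properties.AbelianGroup Γ
    using (identityʳ-unique; inverseˡ-unique; ε⁻¹≈ε; ⁻¹-∙-comm; x≈z//y; //-rightDividesˡ;
           x≈y⇒x∙y⁻¹≈ε; x∙y⁻¹≈ε⇒x≈y)
  open import Algebra.Properties.CommutativeSemigroup commutativeSemigroup using (interchange)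
  open import Relation.Binary.Reasoning.Setoid setoid

  evalT-cong : ∀ {n} (t : Term Γ n) {ρ ρ'} → (∀ i → ρ i ≈ ρ' i) → evalT Γ ρ t ≈ evalT Γ ρ' t
  evalT-cong (var i)   ρ≈ρ' = ρ≈ρ' i
  evalT-cong (param a) ρ≈ρ' = refl
  evalT-cong (s ⊕ t)   ρ≈ρ' = ∙-cong (evalT-cong s ρ≈ρ') (evalT-cong t ρ≈ρ')

  Sat-cong : ∀ {n} (φ : Formula Γ n) {ρ ρ'} → (∀ i → ρ i ≈ ρ' i) → Sat Γ ρ φ → Sat Γ ρ' φ
  Sat-cong (s ≐ t)  ρ≈ρ' (lift s≈t) = lift (trans (sym (evalT-cong s ρ≈ρ')) (trans s≈t (evalT-cong t ρ≈ρ')))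
  Sat-cong (¬' φ)   ρ≈ρ' ¬sat sat  = ¬sat (Sat-cong φ (λ i → sym (ρ≈ρ' i)) sat)
  Sat-cong (φ ∧' ψ) ρ≈ρ' (sat , sat') = Sat-cong φ ρ≈ρ' sat , Sat-cong ψ ρ≈ρ' sat'
  Sat-cong (∃' φ)   ρ≈ρ' (a , sat) = a , Sat-cong φ (λ { Fin.zero → refl ; (Fin.suc i) → ρ≈ρ' i }) sat

  iter-powerMap : ∀ {F} m r (u : Fin m → Carrier) i → iter (powerMap Γ m F) r u i ≡ iter F r (u i)
  iter-powerMap m zero    u i = ≡.refl
  iter-powerMap {F} m (suc r) u i = ≡.cong F (iter-powerMap m r u i)

  linear : ∀ {n} → Term Γ n → (Fin n → Carrier) → Carrier
  linear (var i)   ρ = ρ i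
  linear (param a) ρ = ε
  linear (s ⊕ t)   ρ = linear s ρ ∙ linear t ρ

  constant : ∀ {n} → Term Γ n → Carrier
  constant (var i)   = ε
  constant (param a) = a
  constant (s ⊕ t)   = constant s ∙ constant t

  size : ∀ {n} → Term Γ n → ℕ
  size (var i)   = 1
  size (param a) = 1
  size (s ⊕ t)   = size s + size t

  evalT-split : ∀ {n} (t : Term Γ n) ρ → evalT Γ ρ t ≈ linear t ρ ∙ constant t
  evalT-split (var i)   ρ = sym (identityʳ _)
  evalT-split (param a) ρ = sym (identityˡ _)
  evalT-split (s ⊕ t)   ρ = trans (∙-cong (evalT-split s ρ) (evalT-split t ρ)) (interchange _ _ _ _)

  module Endomorphism {F : Carrier → Carrier} (F-endo : IsInjectiveEndo Γ F) where
    open IsInjectiveEndo F-endo public renaming (cong to F-cong; homo to F-homo; injective to F-injective)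

    F-ε : F ε ≈ ε
    F-ε = identityʳ-unique (F ε) (F ε) (trans (sym (F-homo ε ε)) (F-cong (identityʳ ε)))

    F-⁻¹ : ∀ x → F (x ⁻¹) ≈ F x ⁻¹
    F-⁻¹ x = inverseˡ-unique _ _ (trans (sym (F-homo (x ⁻¹) x)) (trans (F-cong (inverseˡ x)) F-ε))

    F-∙⁻¹ : ∀ x y → F (x ∙ y ⁻¹) ≈ F x ∙ F y ⁻¹
    F-∙⁻¹ x y = trans (F-homo x (y ⁻¹)) (∙-congˡ (F-⁻¹ y))

    x∙Fy≈Fz⇒x≈F[z∙y⁻¹] : ∀ {x y z} → x ∙ F y ≈ F z → x ≈ F (z ∙ y ⁻¹)
    x∙Fy≈Fz⇒x≈F[z∙y⁻¹] {x} {y} {z} eq = trans (x≈z//y x (F y) (F z) eq) (sym (F-∙⁻¹ z y))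

  iter-isInjectiveEndo : ∀ {F} → IsInjectiveEndo Γ F → ∀ n → IsInjectiveEndo Γ (iter F n)
  iter-isInjectiveEndo F-endo zero = record { cong = λ x≈y → x≈y ; homo = λ _ _ → refl ; injective = λ x≈y → x≈y }
  iter-isInjectiveEndo F-endo (suc n) = record
    { cong      = F-cong ∘ Fⁿ.F-cong
    ; homo      = λ x y → trans (F-cong (Fⁿ.F-homo x y)) (F-homo _ _)
    ; injective = Fⁿ.F-injective ∘ F-injective
    }
    where
    open Endomorphism F-endo
    module Fⁿ = Endomorphism (iter-isInjectiveEndo F-endo n)

  -- Expansions in base G and their carries

  module Expansion {G : Carrier → Carrier} (G-endo : IsInjectiveEndo Γ G) where
    open Endomorphism G-endo public

    G^ : ℕ → Carrier → Carrier
    G^ = iter G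

    module G^ n = Endomorphism (iter-isInjectiveEndo G-endo n)

    ⟦_⟧ : List Carrier → Carrier
    ⟦ xs ⟧ = ⟦_⟧[_] rawGroup xs G

    ⟦⟧-++ : ∀ xs ys → ⟦ xs ++ ys ⟧ ≈ ⟦ xs ⟧ ∙ G^ (length xs) ⟦ ys ⟧
    ⟦⟧-++ []       ys = sym (identityˡ _)
    ⟦⟧-++ (x ∷ xs) ys = begin
      x ∙ G ⟦ xs ++ ys ⟧                            ≈⟨ ∙-congˡ (F-cong (⟦⟧-++ xs ys)) ⟩
      x ∙ G (⟦ xs ⟧ ∙ G^ (length xs) ⟦ ys ⟧)         ≈⟨ ∙-congˡ (F-homo _ _) ⟩
      x ∙ (G ⟦ xs ⟧ ∙ G^ (suc (length xs)) ⟦ ys ⟧)   ≈⟨ assoc _ _ _ ⟨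
      x ∙ G ⟦ xs ⟧ ∙ G^ (suc (length xs)) ⟦ ys ⟧     ∎

    ⟦⟧-∷ʳ : ∀ xs y → ⟦ xs ∷ʳ y ⟧ ≈ ⟦ xs ⟧ ∙ G^ (length xs) y
    ⟦⟧-∷ʳ xs y = trans (⟦⟧-++ xs [ y ]) (∙-congˡ (G^.F-cong (length xs) (trans (∙-congˡ F-ε) (identityʳ y))))

    ⟦⟧-replicate : ∀ {x} p → x ≈ ε → ⟦ replicate p x ⟧ ≈ ε
    ⟦⟧-replicate zero    x≈ε = refl
    ⟦⟧-replicate (suc p) x≈ε = trans (∙-cong x≈ε (trans (F-cong (⟦⟧-replicate p x≈ε)) F-ε)) (identityˡ ε)

    ⟦⟧-++-replicate : ∀ xs {x} p → x ≈ ε → ⟦ xs ++ replicate p x ⟧ ≈ ⟦ xs ⟧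
    ⟦⟧-++-replicate xs p x≈ε = begin
      ⟦ xs ++ replicate p _ ⟧                   ≈⟨ ⟦⟧-++ xs _ ⟩
      ⟦ xs ⟧ ∙ G^ (length xs) ⟦ replicate p _ ⟧  ≈⟨ ∙-congˡ (G^.F-cong (length xs) (⟦⟧-replicate p x≈ε)) ⟩
      ⟦ xs ⟧ ∙ G^ (length xs) ε                  ≈⟨ ∙-congˡ (G^.F-ε (length xs)) ⟩
      ⟦ xs ⟧ ∙ ε                                 ≈⟨ identityʳ _ ⟩
      ⟦ xs ⟧                                     ∎

    module _ {B : Set} where
      ⟦⟧-map-ε : ∀ {f : B → Carrier} → (∀ b → f b ≈ ε) → ∀ bs → ⟦ map f bs ⟧ ≈ ε
      ⟦⟧-map-ε f≈ε []       = refl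
      ⟦⟧-map-ε f≈ε (b ∷ bs) = trans (∙-cong (f≈ε b) (trans (F-cong (⟦⟧-map-ε f≈ε bs)) F-ε)) (identityˡ ε)

      ⟦⟧-map-∙ : ∀ (f g : B → Carrier) bs → ⟦ map (λ b → f b ∙ g b) bs ⟧ ≈ ⟦ map f bs ⟧ ∙ ⟦ map g bs ⟧
      ⟦⟧-map-∙ f g []       = sym (identityˡ ε)
      ⟦⟧-map-∙ f g (b ∷ bs) = begin
        (f b ∙ g b) ∙ G ⟦ map (λ b → f b ∙ g b) bs ⟧          ≈⟨ ∙-congˡ (F-cong (⟦⟧-map-∙ f g bs)) ⟩
        (f b ∙ g b) ∙ G (⟦ map f bs ⟧ ∙ ⟦ map g bs ⟧)          ≈⟨ ∙-congˡ (F-homo _ _) ⟩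
        (f b ∙ g b) ∙ (G ⟦ map f bs ⟧ ∙ G ⟦ map g bs ⟧)        ≈⟨ interchange _ _ _ _ ⟩
        (f b ∙ G ⟦ map f bs ⟧) ∙ (g b ∙ G ⟦ map g bs ⟧)        ∎

      ⟦⟧-map-⁻¹ : ∀ (f : B → Carrier) bs → ⟦ map (λ b → f b ⁻¹) bs ⟧ ≈ ⟦ map f bs ⟧ ⁻¹
      ⟦⟧-map-⁻¹ f []       = sym ε⁻¹≈ε
      ⟦⟧-map-⁻¹ f (b ∷ bs) = begin
        f b ⁻¹ ∙ G ⟦ map (λ b → f b ⁻¹) bs ⟧    ≈⟨ ∙-congˡ (F-cong (⟦⟧-map-⁻¹ f bs)) ⟩
        f b ⁻¹ ∙ G (⟦ map f bs ⟧ ⁻¹)            ≈⟨ ∙-congˡ (F-⁻¹ _) ⟩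
        f b ⁻¹ ∙ G ⟦ map f bs ⟧ ⁻¹              ≈⟨ ⁻¹-∙-comm _ _ ⟩
        (f b ∙ G ⟦ map f bs ⟧) ⁻¹               ∎

    -- Adding the digits ds to x leaves the carry c in position length ds.
    record Carry (x : Carrier) (ds : List Carrier) (c : Carrier) : Set ℓ where
      constructor carry
      field
        equation : x ∙ ⟦ ds ⟧ ≈ G^ (length ds) c

    Carry-≈ʳ : ∀ {x ds c c'} → Carry x ds c → c ≈ c' → Carry x ds c'
    Carry-≈ʳ {ds = ds} (carry eq) c≈c' = carry (trans eq (G^.F-cong (length ds) c≈c'))

    Carry-≈ˡ : ∀ {x x' ds c} → x ≈ x' → Carry x ds c → Carry x' ds c
    Carry-≈ˡ x≈x' (carry eq) = carry (trans (∙-congʳ (sym x≈x')) eq)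

    Carry-unique : ∀ {x ds c c'} → Carry x ds c → Carry x ds c' → c ≈ c'
    Carry-unique {ds = ds} (carry eq) (carry eq') = G^.F-injective (length ds) (trans (sym eq) eq')

    Carry-ε⇔ : ∀ {x ds} → Carry x ds ε ⇔ x ∙ ⟦ ds ⟧ ≈ ε
    Carry-ε⇔ {ds = ds} = mk⇔
      (λ (carry eq) → trans eq (G^.F-ε (length ds)))
      (λ eq → carry (trans eq (sym (G^.F-ε (length ds)))))

    Carry-∷ʳ⇔ : ∀ {x ds d c'} → Carry x (ds ∷ʳ d) c' ⇔ (x ∙ ⟦ ds ⟧) ∙ G^ (length ds) d ≈ G^ (length ds) (G c')
    Carry-∷ʳ⇔ {x} {ds} {d} {c'} = mk⇔
      (λ (carry eq) → trans (sym lhs) (trans eq rhs))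
      (λ eq → carry (trans lhs (trans eq (sym rhs))))
      where
      lhs : x ∙ ⟦ ds ∷ʳ d ⟧ ≈ (x ∙ ⟦ ds ⟧) ∙ G^ (length ds) d
      lhs = trans (∙-congˡ (⟦⟧-∷ʳ ds d)) (sym (assoc _ _ _))
      rhs : G^ (length (ds ∷ʳ d)) c' ≈ G^ (length ds) (G c')
      rhs = reflexive (≡.trans (≡.cong (λ n → G^ n c') (length-∷ʳ ds d)) (iter-suc G (length ds) c'))

    Carry-∷ʳ : ∀ {x ds d c c'} → Carry x ds c → Carry x (ds ∷ʳ d) c' ⇔ c ∙ d ≈ G c'
    Carry-∷ʳ {ds = ds} {d} {c} (carry eq) = mk⇔
      (λ carry' → G^.F-injective n (trans prefix (Equivalence.to Carry-∷ʳ⇔ carry')))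
      (λ c∙d≈Gc' → Equivalence.from Carry-∷ʳ⇔ (trans (sym prefix) (G^.F-cong n c∙d≈Gc')))
      where
      n : ℕ
      n = length ds
      prefix : G^ n (c ∙ d) ≈ (_ ∙ ⟦ ds ⟧) ∙ G^ n d
      prefix = trans (G^.F-homo n c d) (∙-congʳ (sym eq))

    Carry-init : ∀ {x ds d c'} → Carry x (ds ∷ʳ d) c' → Carry x ds (G c' ∙ d ⁻¹)
    Carry-init {ds = ds} carry' =
      carry (trans (x≈z//y _ _ _ (Equivalence.to Carry-∷ʳ⇔ carry')) (sym (G^.F-∙⁻¹ (length ds) _ _)))

  module SpanningSet {G : Carrier → Carrier} (G-endo : IsInjectiveEndo Γ G)
                     {k : ℕ} {S : Fin k → Carrier} (spanning : IsSpanningSet rawGroup G k S) where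
    open Expansion G-endo public
    open IsSpanningSet spanning public
    import Algebra.Solver.CommutativeMonoid commutativeMonoid as ∙-Solver

    zero-digit : Fin k
    zero-digit = proj₁ has-zero

    S-zero-digit : S zero-digit ≈ ε
    S-zero-digit = proj₂ has-zero

    sum : ∀ {n} → Vec (Fin k) n → Carrier
    sum []      = ε
    sum (i ∷ v) = S i ∙ sum v

    SumOf : ℕ → Carrier → Set ℓ
    SumOf n x = Σ (Vec (Fin k) n) λ v → sum v ≈ x

    SumOf-≈ : ∀ {n x y} → x ≈ y → SumOf n x → SumOf n y
    SumOf-≈ x≈y (v , eq) = v , trans eq x≈y

    SumOf-ε : ∀ n → SumOf n ε
    SumOf-ε zero    = [] , refl
    SumOf-ε (suc n) = let v , eq = SumOf-ε n in zero-digit ∷ v , trans (∙-cong S-zero-digit eq) (identityˡ ε)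

    SumOf-digit : ∀ i → SumOf 1 (S i)
    SumOf-digit i = i ∷ [] , identityʳ (S i)

    SumOf-∙ : ∀ {m n x y} → SumOf m x → SumOf n y → SumOf (m + n) (x ∙ y)
    SumOf-∙ ([] , eq)    (v' , eq') = v' , trans eq' (trans (sym (identityˡ _)) (∙-congʳ eq))
    SumOf-∙ (i ∷ v , eq) (v' , eq') =
      let v'' , eq'' = SumOf-∙ (v , refl) (v' , eq') in
      i ∷ v'' , trans (∙-congˡ eq'') (trans (sym (assoc _ _ _)) (∙-congʳ eq))

    SumOf-⁻¹ : ∀ {n x} → SumOf n x → SumOf n (x ⁻¹)
    SumOf-⁻¹ ([] , eq)    = [] , trans (sym ε⁻¹≈ε) (⁻¹-cong eq)
    SumOf-⁻¹ (i ∷ v , eq) =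
      let v' , eq' = SumOf-⁻¹ (v , refl) in
      proj₁ (neg-⊆ i) ∷ v' , trans (∙-cong (proj₂ (neg-⊆ i)) eq') (trans (⁻¹-∙-comm _ _) (⁻¹-cong eq))

    SumOf-≤ : ∀ {m n x} → m ≤ n → SumOf m x → SumOf n x
    SumOf-≤ {n = n} z≤n ([] , eq)    = SumOf-≈ eq (SumOf-ε n)
    SumOf-≤ (s≤s m≤n)   (i ∷ v , eq) =
      let v' , eq' = SumOf-≤ m≤n (v , refl) in i ∷ v' , trans (∙-congˡ eq') eq

    -- Property (iii) trades five digits for one digit plus a carry into the next place.
    sum-reduce : ∀ q (v : Vec (Fin k) (suc (q * 4))) → ∃₂ λ i (u : Vec (Fin k) q) → sum v ≈ S i ∙ G (sum u)
    sum-reduce zero    (i ∷ []) = i , [] , ∙-congˡ (sym F-ε)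
    sum-reduce (suc q) (a ∷ b ∷ c ∷ d ∷ v) with i , u , v≈ ← sum-reduce q v
      with j , j' , five ← five-sum a b c d i = j , j' ∷ u , (begin
        S a ∙ (S b ∙ (S c ∙ (S d ∙ sum v)))                ≈⟨ ∙-congˡ (∙-congˡ (∙-congˡ (∙-congˡ v≈))) ⟩
        S a ∙ (S b ∙ (S c ∙ (S d ∙ (S i ∙ G (sum u)))))    ≈⟨ reassociate (S a) (S b) (S c) (S d) (S i) (G (sum u)) ⟩
        (S a ∙ S b ∙ S c ∙ S d ∙ S i) ∙ G (sum u)          ≈⟨ ∙-congʳ five ⟩
        (S j ∙ G (S j')) ∙ G (sum u)                        ≈⟨ assoc _ _ _ ⟩
        S j ∙ (G (S j') ∙ G (sum u))                        ≈⟨ ∙-congˡ (F-homo _ _) ⟨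
        S j ∙ G (S j' ∙ sum u)                              ∎)
      where
      open ∙-Solver using (solve; _⊜_; _⊕_)
      reassociate : ∀ a b c d e f → a ∙ (b ∙ (c ∙ (d ∙ (e ∙ f)))) ≈ (a ∙ b ∙ c ∙ d ∙ e) ∙ f
      reassociate = solve 6
        (λ a b c d e f → a ⊕ (b ⊕ (c ⊕ (d ⊕ (e ⊕ f)))) ⊜ ((((a ⊕ b) ⊕ c) ⊕ d) ⊕ e) ⊕ f) refl

    -- The leftover digit S i is divisible by G, so property (iv), padded with two zero digits, makes it G of a digit.
    SumOf-contract : ∀ q {x z} → SumOf (suc (q * 4)) x → x ≈ G z → SumOf (suc q) z
    SumOf-contract q {x} {z} (v , v≈x) x≈Gz with i , u , v≈ ← sum-reduce q v = j ∷ u , F-injective (begin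
      G (S j ∙ sum u)          ≈⟨ F-homo _ _ ⟩
      G (S j) ∙ G (sum u)      ≈⟨ ∙-congʳ Si≈GSj ⟨
      S i ∙ G (sum u)          ≈⟨ v≈ ⟨
      sum v                    ≈⟨ v≈x ⟩
      x                        ≈⟨ x≈Gz ⟩
      G z                      ∎)
      where
      Si≈G : S i ≈ G (z ∙ sum u ⁻¹)
      Si≈G = x∙Fy≈Fz⇒x≈F[z∙y⁻¹] (trans (sym v≈) (trans v≈x x≈Gz))
      Si00≈Si : S i ∙ S zero-digit ∙ S zero-digit ≈ S i
      Si00≈Si = trans (∙-cong (trans (∙-congˡ S-zero-digit) (identityʳ _)) S-zero-digit) (identityʳ _)
      three : Σ (Fin k) λ j → S i ∙ S zero-digit ∙ S zero-digit ≈ G (S j)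
      three = three-sum i zero-digit zero-digit (_ , trans Si00≈Si Si≈G)
      j : Fin k
      j = proj₁ three
      Si≈GSj : S i ≈ G (S j)
      Si≈GSj = trans (sym Si00≈Si) (proj₂ three)

    zero-digit-∙G-ε : ∀ {x} → x ≈ ε → S zero-digit ∙ G x ≈ ε
    zero-digit-∙G-ε x≈ε = trans (∙-cong S-zero-digit (trans (F-cong x≈ε) F-ε)) (identityˡ ε)

    head₀ : List (Fin k) → Fin k
    head₀ []      = zero-digit
    head₀ (i ∷ _) = i

    tail₀ : List (Fin k) → List (Fin k)
    tail₀ []      = []
    tail₀ (_ ∷ γ) = γ

    ⟦⟧-uncons₀ : ∀ γ → ⟦ map S γ ⟧ ≈ S (head₀ γ) ∙ G ⟦ map S (tail₀ γ) ⟧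
    ⟦⟧-uncons₀ []      = sym (zero-digit-∙G-ε refl)
    ⟦⟧-uncons₀ (i ∷ γ) = refl

    ∈-tails-tail₀ : ∀ {γ' : List (Fin k)} γ → γ' ∈ tails (tail₀ γ) → γ' ∈ tails γ
    ∈-tails-tail₀ []      γ'∈ = γ'∈
    ∈-tails-tail₀ (i ∷ γ) γ'∈ = there γ'∈

    digit-count-bound : ∀ q → suc (suc q) + 1 + suc q ≤ suc (suc q * 4)
    digit-count-bound q = ≤-trans (m≤m+n _ (q + q + 1)) (≤-reflexive (count q))
      where
      count : ∀ q → suc (suc q) + 1 + suc q + (q + q + 1) ≡ suc (suc q * 4)
      count = solve-∀

    -- A carry of q + 2 generators, the next digit of γ and a digit of q + 1 generators make at most
    -- 4 (q + 1) + 1 generators, so SumOf-contract brings the next carry back to q + 2 generators.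
    carry-bound : ∀ q ds γ {s c} → All (SumOf (suc q)) ds → SumOf (2 + q) s → Carry (s ∙ ⟦ map S γ ⟧) ds c →
      ∃₂ λ (v : Vec (Fin k) (2 + q)) γ' → γ' ∈ tails γ × c ≈ sum v ∙ ⟦ map S γ' ⟧
    carry-bound q [] γ [] (v , v≈s) (carry eq) =
      v , γ , here ≡.refl , trans (sym eq) (trans (identityʳ _) (∙-congʳ (sym v≈s)))
    carry-bound q (d ∷ ds) γ {s} {c} (d-small ∷ ds-small) s-small (carry eq) =
      let v , γ' , γ'∈ , c≈ = carry-bound q ds (tail₀ γ) ds-small z-small carry'
      in  v , γ' , ∈-tails-tail₀ γ γ'∈ , c≈
      where
      h T D z : Carrier
      h = S (head₀ γ)
      T = ⟦ map S (tail₀ γ) ⟧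
      D = ⟦ ds ⟧
      z = G^ (length ds) c ∙ (T ∙ D) ⁻¹
      open ∙-Solver using (solve; _⊜_; _⊕_)
      regroup : ∀ s h t d x → (s ∙ (h ∙ t)) ∙ (d ∙ x) ≈ ((s ∙ h) ∙ d) ∙ (t ∙ x)
      regroup = solve 5 (λ s h t d x → (s ⊕ (h ⊕ t)) ⊕ (d ⊕ x) ⊜ ((s ⊕ h) ⊕ d) ⊕ (t ⊕ x)) refl
      shd≈Gz : s ∙ h ∙ d ≈ G z
      shd≈Gz = x∙Fy≈Fz⇒x≈F[z∙y⁻¹] (begin
        (s ∙ h ∙ d) ∙ G (T ∙ D)          ≈⟨ ∙-congˡ (F-homo T D) ⟩
        (s ∙ h ∙ d) ∙ (G T ∙ G D)        ≈⟨ regroup s h (G T) d (G D) ⟨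
        (s ∙ (h ∙ G T)) ∙ (d ∙ G D)      ≈⟨ ∙-congʳ (∙-congˡ (⟦⟧-uncons₀ γ)) ⟨
        (s ∙ ⟦ map S γ ⟧) ∙ (d ∙ G D)    ≈⟨ eq ⟩
        G (G^ (length ds) c)             ∎)
      z-small : SumOf (2 + q) z
      z-small = SumOf-contract (suc q)
        (SumOf-≤ (digit-count-bound q) (SumOf-∙ (SumOf-∙ s-small (SumOf-digit (head₀ γ))) d-small)) shd≈Gz
      carry' : Carry (z ∙ T) ds c
      carry' = carry (trans (assoc z T D) (//-rightDividesˡ (T ∙ D) (G^ (length ds) c)))

    -- Languages of formulas

    Column : ℕ → Set
    Column n = Fin n → Fin k

    zero-column : ∀ {n} → Column n
    zero-column _ = zero-digit

    -- A word of columns spells n expansions in parallel: coordinate i has digit S (col i) in each column.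
    value : ∀ {n} → List (Column n) → Fin n → Carrier
    value w i = ⟦ map (λ col → S (col i)) w ⟧

    value-++-zeros : ∀ {n} (w : List (Column n)) p i → value (w ++ replicate p zero-column) i ≈ value w i
    value-++-zeros w p i = begin
      ⟦ map f (w ++ replicate p zero-column) ⟧        ≡⟨ ≡.cong ⟦_⟧ (map-++ f w _) ⟩
      ⟦ map f w ++ map f (replicate p zero-column) ⟧  ≡⟨ ≡.cong (λ ds → ⟦ map f w ++ ds ⟧) (map-replicate f p _) ⟩
      ⟦ map f w ++ replicate p (S zero-digit) ⟧       ≈⟨ ⟦⟧-++-replicate (map f w) p S-zero-digit ⟩
      ⟦ map f w ⟧                                     ∎
      where
      f : Column _ → Carrier
      f col = S (col i)

    value-map-tail : ∀ {n} (u : List (Column (suc n))) i → value (map VF.tail u) i ≡ value u (Fin.suc i)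
    value-map-tail u i = ≡.cong ⟦_⟧ (≡.sym (map-∘ u))

    stack : ∀ {n} → List (Fin k) → List (Column n) → List (Column (suc n))
    stack []      []        = []
    stack []      (col ∷ w) = (zero-digit VF.∷ col) ∷ stack [] w
    stack (j ∷ σ) []        = (j VF.∷ zero-column) ∷ stack σ []
    stack (j ∷ σ) (col ∷ w) = (j VF.∷ col) ∷ stack σ w

    map-tail-stack : ∀ {n} σ (w : List (Column n)) → ∃ λ p → map VF.tail (stack σ w) ≡ w ++ replicate p zero-column
    map-tail-stack []      []        = 0 , ≡.refl
    map-tail-stack []      (col ∷ w) = let p , eq = map-tail-stack [] w in p , ≡.cong (col ∷_) eq
    map-tail-stack (j ∷ σ) []        = let p , eq = map-tail-stack σ [] in suc p , ≡.cong (zero-column ∷_) eq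
    map-tail-stack (j ∷ σ) (col ∷ w) = let p , eq = map-tail-stack σ w in p , ≡.cong (col ∷_) eq

    value-stack : ∀ {n} σ (w : List (Column n)) i → value (stack σ w) i ≈ (⟦ map S σ ⟧ VF.∷ value w) i
    value-stack []      []        Fin.zero    = refl
    value-stack []      []        (Fin.suc i) = refl
    value-stack []      (col ∷ w) Fin.zero    = zero-digit-∙G-ε (value-stack [] w Fin.zero)
    value-stack []      (col ∷ w) (Fin.suc i) = ∙-congˡ (F-cong (value-stack [] w (Fin.suc i)))
    value-stack (j ∷ σ) []        Fin.zero    = ∙-congˡ (F-cong (value-stack σ [] Fin.zero))
    value-stack (j ∷ σ) []        (Fin.suc i) = zero-digit-∙G-ε (value-stack σ [] (Fin.suc i))
    value-stack (j ∷ σ) (col ∷ w) Fin.zero    = ∙-congˡ (F-cong (value-stack σ w Fin.zero))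
    value-stack (j ∷ σ) (col ∷ w) (Fin.suc i) = ∙-congˡ (F-cong (value-stack σ w (Fin.suc i)))

    value-spans : ∀ n (a : Fin n → Carrier) → ∃ λ (w : List (Column n)) → ∀ i → value w i ≈ a i
    value-spans zero    a = [] , λ ()
    value-spans (suc n) a =
      let σ , σ≈ = spans (a Fin.zero) ; w , w≈ = value-spans n (a ∘ Fin.suc) in
      stack σ w , λ { Fin.zero → trans (value-stack σ w Fin.zero) σ≈
                    ; (Fin.suc i) → trans (value-stack σ w (Fin.suc i)) (w≈ i) }

    ∃-padded⇔Sat-∃' : ∀ {n} (φ : Formula Γ (suc n)) (w : List (Column n)) →
      (∃ λ p → ∃ λ u → map VF.tail u ≡ w ++ replicate p zero-column × Sat Γ (value u) φ) ⇔
      Sat Γ (value w) (∃' φ)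
    ∃-padded⇔Sat-∃' φ w = mk⇔
      (λ (p , u , tail≡ , sat) → value u Fin.zero , Sat-cong φ (λ
        { Fin.zero    → refl
        ; (Fin.suc i) → trans (reflexive (≡.trans (≡.sym (value-map-tail u i)) (≡.cong (λ v → value v i) tail≡)))
                              (value-++-zeros w p i) }) sat)
      (λ (a , sat) →
        let σ , σ≈a = spans a ; p , tail≡ = map-tail-stack σ w in
        p , stack σ w , tail≡ , Sat-cong φ (λ
          { Fin.zero    → sym (trans (value-stack σ w Fin.zero) σ≈a)
          ; (Fin.suc i) → sym (value-stack σ w (Fin.suc i)) }) sat)

    linear-value : ∀ {n} (t : Term Γ n) (w : List (Column n)) →
      linear t (value w) ≈ ⟦ map (λ col → linear t (S ∘ col)) w ⟧
    linear-value (var i)   w = refl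
    linear-value (param a) w = sym (⟦⟧-map-ε (λ _ → refl) w)
    linear-value (s ⊕ t)   w = trans (∙-cong (linear-value s w) (linear-value t w)) (sym (⟦⟧-map-∙ _ _ w))

    linear-SumOf : ∀ {n} (t : Term Γ n) (col : Column n) → SumOf (size t) (linear t (S ∘ col))
    linear-SumOf (var i)   col = SumOf-digit (col i)
    linear-SumOf (param a) col = SumOf-ε 1
    linear-SumOf (s ⊕ t)   col = SumOf-∙ (linear-SumOf s col) (linear-SumOf t col)

    -- s ≐ t holds iff the constant [γ] plus the columnwise digits of s - t adds up to zero; the
    -- automaton tracks the carry of this addition, which ranges over a finite set by carry-bound.
    module Atom (em : ExcludedMiddle (c ⊔ ℓ)) {n} (s t : Term Γ n) where
      digit : Column n → Carrier
      digit col = linear s (S ∘ col) ∙ linear t (S ∘ col) ⁻¹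

      q : ℕ
      q = size s + size t

      digit-SumOf : ∀ col → SumOf (suc q) (digit col)
      digit-SumOf col = SumOf-≤ (n≤1+n q) (SumOf-∙ (linear-SumOf s col) (SumOf-⁻¹ (linear-SumOf t col)))

      γ : List (Fin k)
      γ = proj₁ (spans (constant s ∙ constant t ⁻¹))

      origin : Carrier
      origin = ⟦ map S γ ⟧

      difference : ∀ w → evalT Γ (value w) s ∙ evalT Γ (value w) t ⁻¹ ≈ origin ∙ ⟦ map digit w ⟧
      difference w = begin
        evalT Γ (value w) s ∙ evalT Γ (value w) t ⁻¹
          ≈⟨ ∙-cong (evalT-split s (value w)) (⁻¹-cong (evalT-split t (value w))) ⟩
        (linear s (value w) ∙ constant s) ∙ (linear t (value w) ∙ constant t) ⁻¹
          ≈⟨ ∙-congˡ (⁻¹-∙-comm _ _) ⟨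
        (linear s (value w) ∙ constant s) ∙ (linear t (value w) ⁻¹ ∙ constant t ⁻¹)
          ≈⟨ interchange _ _ _ _ ⟩
        (linear s (value w) ∙ linear t (value w) ⁻¹) ∙ (constant s ∙ constant t ⁻¹)
          ≈⟨ ∙-cong (∙-cong (linear-value s w) (⁻¹-cong (linear-value t w))) (sym (proj₂ (spans _))) ⟩
        (⟦ map (λ col → linear s (S ∘ col)) w ⟧ ∙ ⟦ map (λ col → linear t (S ∘ col)) w ⟧ ⁻¹) ∙ origin
          ≈⟨ ∙-congʳ (∙-congˡ (⟦⟧-map-⁻¹ _ w)) ⟨
        (⟦ map (λ col → linear s (S ∘ col)) w ⟧ ∙ ⟦ map (λ col → linear t (S ∘ col) ⁻¹) w ⟧) ∙ origin
          ≈⟨ ∙-congʳ (⟦⟧-map-∙ _ _ w) ⟨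
        ⟦ map digit w ⟧ ∙ origin
          ≈⟨ comm _ _ ⟩
        origin ∙ ⟦ map digit w ⟧
          ∎

      Sat-≐⇔ : ∀ w → Sat Γ (value w) (s ≐ t) ⇔ Carry origin (map digit w) ε
      Sat-≐⇔ w = mk⇔
        (λ (lift s≈t) → Equivalence.from Carry-ε⇔ (trans (sym (difference w)) (x≈y⇒x∙y⁻¹≈ε s≈t)))
        (λ alive → lift (x∙y⁻¹≈ε⇒x≈y _ _ (trans (difference w) (Equivalence.to Carry-ε⇔ alive))))

      Alive : List (Column n) → Set (c ⊔ ℓ)
      Alive w = Σ Carrier (Carry origin (map digit w))

      carry-∷ʳ : ∀ {w c e} col → Carry origin (map digit w) c →
        Carry origin (map digit (w ∷ʳ col)) e ⇔ c ∙ digit col ≈ G e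
      carry-∷ʳ {w} {c} {e} col alive =
        ≡.subst (λ ds → Carry origin ds e ⇔ c ∙ digit col ≈ G e) (≡.sym (map-++ digit w [ col ])) (Carry-∷ʳ alive)

      Alive-init : ∀ {w} col → Alive (w ∷ʳ col) → Alive w
      Alive-init {w} col (e , alive) =
        G e ∙ digit col ⁻¹ , Carry-init (≡.subst (λ ds → Carry origin ds e) (map-++ digit w [ col ]) alive)

      Alive-∷ʳ : ∀ {w w' c c'} col → Carry origin (map digit w) c → Carry origin (map digit w') c' → c ≈ c' →
        Alive (w ∷ʳ col) → Alive (w' ∷ʳ col)
      Alive-∷ʳ col alive alive' c≈c' (e , alive-col) =
        e , Equivalence.from (carry-∷ʳ col alive')
              (trans (∙-congʳ (sym c≈c')) (Equivalence.to (carry-∷ʳ col alive) alive-col))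

      K : Setoid c (c ⊔ ℓ)
      K = Maybeₚ.setoid setoid

      open Setoid K using () renaming (_≈_ to _≈ₖ_)
      open SetoidMembership K using () renaming (_∈_ to _∈ₖ_)

      classOf : ∀ w → Dec (Alive w) → Maybe Carrier
      classOf _ (yes (c , _)) = just c
      classOf _ (no _)        = nothing

      carryValue : Vec (Fin k) (2 + q) × List (Fin k) → Maybe Carrier
      carryValue (v , γ') = just (sum v ∙ ⟦ map S γ' ⟧)

      classes : List (Maybe Carrier)
      classes = nothing ∷ map carryValue (cartesianProduct (allVecs (allFin k) (2 + q)) (tails γ))

      classOf∈classes : ∀ {w} (alive? : Dec (Alive w)) → classOf w alive? ∈ₖ classes
      classOf∈classes     (no _)            = here Maybeₚ.nothing
      classOf∈classes {w} (yes (c , alive)) =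
        let v , γ' , γ'∈ , c≈ = carry-bound q (map digit w) γ (map⁺ (universal digit-SumOf w)) (SumOf-ε (2 + q))
                                  (Carry-≈ˡ (sym (identityˡ origin)) alive)
        in there (Any.map (λ eq → ≡.subst (just c ≈ₖ_) eq (Maybeₚ.just c≈))
                   (∈-map⁺ carryValue (∈-cartesianProduct⁺ (∈-allVecs ∈-allFin v) γ'∈)))

      classOf-∷ʳ : ∀ {w w'} col (a₁ : Dec (Alive w)) (a₂ : Dec (Alive w'))
        (a₃ : Dec (Alive (w ∷ʳ col))) (a₄ : Dec (Alive (w' ∷ʳ col))) →
        classOf w a₁ ≈ₖ classOf w' a₂ → classOf (w ∷ʳ col) a₃ ≈ₖ classOf (w' ∷ʳ col) a₄
      classOf-∷ʳ col (no ¬a₁) _ (yes a₃) _ _ = ⊥-elim (¬a₁ (Alive-init col a₃))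
      classOf-∷ʳ col _ (no ¬a₂) _ (yes a₄) _ = ⊥-elim (¬a₂ (Alive-init col a₄))
      classOf-∷ʳ col _ _ (no _) (no _) _ = Maybeₚ.nothing
      classOf-∷ʳ col (yes (c , a₁)) (yes (c' , a₂)) (yes (e , a₃)) (yes (e' , a₄)) (Maybeₚ.just c≈c') =
        Maybeₚ.just (F-injective (begin
          G e             ≈⟨ Equivalence.to (carry-∷ʳ col a₁) a₃ ⟨
          c ∙ digit col   ≈⟨ ∙-congʳ c≈c' ⟩
          c' ∙ digit col  ≈⟨ Equivalence.to (carry-∷ʳ col a₂) a₄ ⟩
          G e'            ∎))
      classOf-∷ʳ col (yes (c , a₁)) (yes (c' , a₂)) (yes (e , a₃)) (no ¬a₄) (Maybeₚ.just c≈c') =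
        ⊥-elim (¬a₄ (Alive-∷ʳ col a₁ a₂ c≈c' (e , a₃)))
      classOf-∷ʳ col (yes (c , a₁)) (yes (c' , a₂)) (no ¬a₃) (yes (e , a₄)) (Maybeₚ.just c≈c') =
        ⊥-elim (¬a₃ (Alive-∷ʳ col a₂ a₁ (sym c≈c') (e , a₄)))
      classOf-∷ʳ col (yes _) (no _) _ _ ()
      classOf-∷ʳ col (no _) (yes _) _ _ ()

      classOf-saturates : ∀ {w w'} (a₁ : Dec (Alive w)) (a₂ : Dec (Alive w')) →
        classOf w a₁ ≈ₖ classOf w' a₂ → Sat Γ (value w) (s ≐ t) → Sat Γ (value w') (s ≐ t)
      classOf-saturates {w} (no ¬a₁) _ _ sat = ⊥-elim (¬a₁ (ε , Equivalence.to (Sat-≐⇔ w) sat))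
      classOf-saturates {w} {w'} (yes (c , a₁)) (yes (c' , a₂)) (Maybeₚ.just c≈c') sat =
        Equivalence.from (Sat-≐⇔ w') (Carry-≈ʳ a₂ (trans (sym c≈c') c≈ε))
        where
        c≈ε : c ≈ ε
        c≈ε = Carry-unique a₁ (Equivalence.to (Sat-≐⇔ w) sat)
      classOf-saturates (yes _) (no _) ()

      finiteRightCongruence : FiniteRightCongruence K (Column n) (λ w → Sat Γ (value w) (s ≐ t))
      finiteRightCongruence = record
        { class           = λ w → classOf w (em {Alive w})
        ; classes         = classes
        ; class∈classes   = λ w → classOf∈classes (em {Alive w})
        ; class-∷ʳ        = λ col → classOf-∷ʳ col em em em em
        ; class-saturates = classOf-saturates em em
        }

    Recognizable-Sat : ExcludedMiddle (c ⊔ ℓ) → ∀ {n} (φ : Formula Γ n) →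
      Recognizable (Column n) (λ w → Sat Γ (value w) φ)
    Recognizable-Sat em (s ≐ t)  = FiniteRightCongruence⇒Recognizable em (Atom.finiteRightCongruence em s t)
    Recognizable-Sat em (¬' φ)   = Recognizable-¬ (Recognizable-Sat em φ)
    Recognizable-Sat em (φ ∧' ψ) = Recognizable-× (lowerExcludedMiddle em) (Recognizable-Sat em φ) (Recognizable-Sat em ψ)
    Recognizable-Sat em (∃' φ)   = Recognizable-resp (∃-padded⇔Sat-∃' φ)
      (Recognizable-padded zero-column (Recognizable-image VF.tail (lowerExcludedMiddle em) (Recognizable-Sat em φ)))

    -- The spanning set of Γᵐ

    module Power (m : ℕ) (Gᵐ : (Fin m → Carrier) → Fin m → Carrier) (Gᵐ-coord : ∀ u i → Gᵐ u i ≈ G (u i)) where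
      decode : Fin (k ^ m) → Column m
      decode = finToFun

      encode : Column m → Fin (k ^ m)
      encode = funToFin

      Sᵐ : Fin (k ^ m) → Fin m → Carrier
      Sᵐ j i = S (decode j i)

      ⟦_⟧ᵐ : List (Fin m → Carrier) → Fin m → Carrier
      ⟦ us ⟧ᵐ = ⟦_⟧[_] (power Γ m) us Gᵐ

      ⟦⟧ᵐ-value : ∀ σ i → ⟦ map Sᵐ σ ⟧ᵐ i ≈ value (map decode σ) i
      ⟦⟧ᵐ-value []      i = refl
      ⟦⟧ᵐ-value (j ∷ σ) i = ∙-congˡ (trans (Gᵐ-coord _ i) (F-cong (⟦⟧ᵐ-value σ i)))

      Sᵐ-encode : ∀ f i → Sᵐ (encode f) i ≈ S (f i)
      Sᵐ-encode f i = reflexive (≡.cong S (finToFun-funToFin {m} {k} f i))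

      value-decode-encode : ∀ w i → value (map decode (map encode w)) i ≈ value w i
      value-decode-encode []        i = refl
      value-decode-encode (col ∷ w) i = ∙-cong (Sᵐ-encode col i) (F-cong (value-decode-encode w i))

      isSpanningSet : IsSpanningSet (power Γ m) Gᵐ (k ^ m) Sᵐ
      isSpanningSet = record
        { distinct  = λ j j' Sj≈Sj' → ≡.trans (≡.sym (funToFin-finToFin {m} {k} j))
            (≡.trans (funToFin-cong (λ i → distinct _ _ (Sj≈Sj' i))) (funToFin-finToFin {m} {k} j'))
        ; spans     = λ a → let w , w≈a = value-spans m a in
            map encode w , λ i → trans (⟦⟧ᵐ-value (map encode w) i) (trans (value-decode-encode w i) (w≈a i))
        ; has-zero  = encode (λ _ → zero-digit) , λ i → trans (Sᵐ-encode _ i) S-zero-digit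
        ; neg-⊆     = λ j → encode (λ i → proj₁ (neg-⊆ (decode j i))) ,
            λ i → trans (Sᵐ-encode _ i) (proj₂ (neg-⊆ _))
        ; neg-⊇     = λ j → encode (λ i → proj₁ (neg-⊇ (decode j i))) ,
            λ i → trans (proj₂ (neg-⊇ _)) (⁻¹-cong (sym (Sᵐ-encode _ i)))
        ; five-sum  = λ j₁ j₂ j₃ j₄ j₅ →
            let five i = five-sum (decode j₁ i) (decode j₂ i) (decode j₃ i) (decode j₄ i) (decode j₅ i) in
            encode (proj₁ ∘ five) , encode (proj₁ ∘ proj₂ ∘ five) , λ i →
              trans (proj₂ (proj₂ (five i)))
                    (∙-cong (sym (Sᵐ-encode _ i)) (sym (trans (Gᵐ-coord _ i) (F-cong (Sᵐ-encode _ i)))))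
        ; three-sum = λ j₁ j₂ j₃ (d , sum≈Gd) →
            let three i = three-sum (decode j₁ i) (decode j₂ i) (decode j₃ i) (d i , trans (sum≈Gd i) (Gᵐ-coord d i)) in
            encode (proj₁ ∘ three) , λ i →
              trans (proj₂ (three i)) (sym (trans (Gᵐ-coord _ i) (F-cong (Sᵐ-encode _ i))))
        }

lemma7p6 : ∀ {c ℓ p} → ExcludedMiddle (c ⊔ ℓ ⊔ p) →
    (Γ : AbelianGroup c ℓ) → Infinite Γ →
    (F : AbelianGroup.Carrier Γ → AbelianGroup.Carrier Γ) → IsInjectiveEndo Γ F →
    (Σ ℕ λ r → r > 0 × HasSpanningSet (AbelianGroup.rawGroup Γ) (iter F r)) →
    (m : ℕ) → m ≥ 1 →
    (X : (Fin m → AbelianGroup.Carrier Γ) → Set p) → Definable Γ m X →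
    Automatic (power Γ m) (powerMap Γ m F) X
lemma7p6 {c} {ℓ} {p} em Γ _ F F-endo (r , r>0 , k , S , spanning) m _ X (φ , X⇔φ) =
  r , r>0 , k ^ m , Sᵐ , isSpanningSet ,
  Recognizable⇒Regular (lowerExcludedMiddle {l = c ⊔ ℓ} em)
    (Recognizable-resp Sat⇔X (Recognizable-map decode (Recognizable-Sat (lowerExcludedMiddle {l = p} em) φ)))
  where
  open AbelianGroup Γ using (sym; reflexive)
  open SpanningSet Γ (iter-isInjectiveEndo Γ F-endo r) spanning
  open Power m (iter (powerMap Γ m F) r) (λ u i → reflexive (iter-powerMap Γ m r u i))

  Sat⇔X : ∀ σ → Sat Γ (value (map decode σ)) φ ⇔ X ⟦ map Sᵐ σ ⟧ᵐ
  Sat⇔X σ = mk⇔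
    (λ sat → Equivalence.from (X⇔φ _) (Sat-cong Γ φ (λ i → sym (⟦⟧ᵐ-value σ i)) sat))
    (λ x → Sat-cong Γ φ (⟦⟧ᵐ-value σ) (Equivalence.to (X⇔φ _) x))
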